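{- Let $n\geq 3$, let $D_n$ be the $n$-dimensional dual cube, let $k\geq 1$ and $l\geq 1$, let $C_1,\dots,C_k$ be distinct clusters of class $0$ and $C'_1,\dots,C'_l$ be distinct clusters of class $1$ of $D_n$. Then the subgraph $H$ of $D_n$ induced by $\left(\bigcup_{j=1}^{k}V(C_j)\right)\cup\left(\bigcup_{i=1}^{l}V(C'_i)\right)$ is connected.
   Context: The $n$-dimensional dual cube $D_n$ has vertex set all binary strings $u_1u_2\cdots u_{2n-1}$ of length $2n-1$; two vertices $u,v$ are adjacent iff they differ in exactly one bit position $i$, and either $1\leq i\leq n-1$ and $u_{2n-1}=v_{2n-1}=0$, or $n\leq i\leq 2n-2$ and $u_{2n-1}=v_{2n-1}=1$, or $i=2n-1$. A cluster of class $0$ is the set of vertices with last bit $0$ and fixed bits in positions $n,\dots,2n-2$ (inducing a copy of $Q_{n-1}$); a cluster of class $1$ is the set of vertices with last bit $1$ and fixed bits in positions $1,\dots,n-1$ (inducing a copy of $Q_{n-1}$). -}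

module Defs where

open import Data.Nat using (ℕ; zero; suc; _+_; _*_; _∸_; _≤_; _<_)
open import Data.Bool using (Bool; true; false)
open import Data.Fin using (Fin; toℕ)
open import Data.Vec using (Vec; lookup)
open import Data.Product using (Σ; _×_; ∃)
open import Data.Sum using (_⊎_)
open import Relation.Binary.PropositionalEquality using (_≡_; _≢_)

-- A vertex of the n-dimensional dual cube D_n: a binary string u₁u₂⋯u_{2n-1}.
-- Position p (1-based, as in the paper) is stored at Fin index p - 1.
Vertex : ℕ → Set
Vertex n = Vec Bool (2 * n ∸ 1)

LastBit : (n : ℕ) → Vertex n → Bool → Set
LastBit n u b = ∀ (j : Fin (2 * n ∸ 1)) → toℕ j ≡ 2 * n ∸ 2 → lookup u j ≡ b

-- Adjacency in D_n: u, v differ in exactly one position i (1-based), and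
--   1 ≤ i ≤ n-1 and u_{2n-1} = v_{2n-1} = 0, or
--   n ≤ i ≤ 2n-2 and u_{2n-1} = v_{2n-1} = 1, or
--   i = 2n-1.
-- With the 0-based index j = i - 1 these read j < n-1, n-1 ≤ j < 2n-2, j = 2n-2.
Adj : (n : ℕ) → Vertex n → Vertex n → Set
Adj n u v =
  Σ (Fin (2 * n ∸ 1)) λ j →
    (lookup u j ≢ lookup v j)
    × (∀ (j' : Fin (2 * n ∸ 1)) → j' ≢ j → lookup u j' ≡ lookup v j')
    × ( (toℕ j < n ∸ 1 × LastBit n u false × LastBit n v false)
      ⊎ ((n ∸ 1 ≤ toℕ j × toℕ j < 2 * n ∸ 2) × LastBit n u true × LastBit n v true)
      ⊎ toℕ j ≡ 2 * n ∸ 2 )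

-- A cluster of class 0 is determined by its fixed bits in positions n,…,2n-2,
-- given as a label a : Vec Bool (n-1) (label index t ↔ position n + t).
InCluster0 : (n : ℕ) → Vec Bool (n ∸ 1) → Vertex n → Set
InCluster0 n a u =
  LastBit n u false
  × (∀ (j : Fin (2 * n ∸ 1)) (t : Fin (n ∸ 1)) →
       toℕ j ≡ (n ∸ 1) + toℕ t → lookup u j ≡ lookup a t)

-- A cluster of class 1 is determined by its fixed bits in positions 1,…,n-1,
-- given as a label a : Vec Bool (n-1) (label index t ↔ position 1 + t).
InCluster1 : (n : ℕ) → Vec Bool (n ∸ 1) → Vertex n → Set
InCluster1 n a u =
  LastBit n u true
  × (∀ (j : Fin (2 * n ∸ 1)) (t : Fin (n ∸ 1)) →
       toℕ j ≡ toℕ t → lookup u j ≡ lookup a t)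

data InducedPath (n : ℕ) (P : Vertex n → Set) : Vertex n → Vertex n → Set where
  here  : ∀ {u} → P u → InducedPath n P u u
  step  : ∀ {u v w} → P u → Adj n u v → InducedPath n P v w → InducedPath n P u w

InducedConnected : (n : ℕ) → (Vertex n → Set) → Set
InducedConnected n P =
  ∃ P × (∀ u v → P u → P v → InducedPath n P u v)

-- A class-0 cluster with label a and a class-1 cluster with label b are joined by
-- an edge: the vertex with bits b in positions 1,…,n-1, bits a in positions
-- n,…,2n-2 and last bit 0 lies in the former, and flipping its last bit lands in
-- the latter. Each cluster is a subcube, hence connected by fixing bits one at a
-- time, so any two vertices of H are joined through one fixed pair of clusters.
module Submission where

open import Defs
open import Data.Nat using (ℕ; zero; suc; _+_; _*_; _∸_; _≤_; _<_; z≤n; s≤s; _<?_)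
open import Data.Nat.Properties
open import Data.Bool using (Bool; true; false; if_then_else_)
open import Data.Bool.Properties using () renaming (_≟_ to _≟ᴮ_)
open import Data.Fin using (Fin; toℕ; fromℕ<) renaming (zero to fzero; suc to fsuc)
open import Data.Fin.Properties using (toℕ-fromℕ<; toℕ-injective; toℕ<n)
open import Data.Vec using (Vec; []; _∷_; _++_; lookup; tabulate)
open import Data.Vec.Properties using (lookup∘tabulate)
open import Data.Vec.Relation.Binary.Pointwise.Extensional using (ext; Pointwise-≡⇒≡)
open import Data.Product using (Σ; ∃; ∃₂; _×_; _,_; proj₁; proj₂)
open import Data.Sum using (_⊎_; inj₁; inj₂)
open import Function using (_∘_)
open import Function.Definitions using (Injective)
open import Relation.Binary using (tri<; tri≈; tri>)
open import Relation.Nullary using (Dec; does; yes; no; ¬_; contradiction)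
open import Relation.Nullary.Decidable using (dec-true; dec-false)
open import Relation.Binary.PropositionalEquality

module _ {A : Set} {N : ℕ} where

  splice : ℕ → Vec A N → Vec A N → Vec A N
  splice k u v = tabulate λ j → if does (toℕ j <? k) then lookup v j else lookup u j

  splice-below : ∀ {k} (u v : Vec A N) {j} → toℕ j < k → lookup (splice k u v) j ≡ lookup v j
  splice-below {k} u v {j} j<k = trans (lookup∘tabulate _ j)
    (cong (if_then lookup v j else lookup u j) (dec-true (toℕ j <? k) j<k))

  splice-above : ∀ {k} (u v : Vec A N) {j} → k ≤ toℕ j → lookup (splice k u v) j ≡ lookup u j
  splice-above {k} u v {j} k≤j = trans (lookup∘tabulate _ j)
    (cong (if_then lookup v j else lookup u j) (dec-false (toℕ j <? k) (≤⇒≯ k≤j)))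

  splice-zero : (u v : Vec A N) → splice 0 u v ≡ u
  splice-zero u v = Pointwise-≡⇒≡ (ext λ j → splice-above u v z≤n)

  splice-full : (u v : Vec A N) → splice N u v ≡ v
  splice-full u v = Pointwise-≡⇒≡ (ext λ j → splice-below u v (toℕ<n j))

  splice-suc-elsewhere : ∀ k (u v : Vec A N) {j} → toℕ j ≢ k →
                         lookup (splice (suc k) u v) j ≡ lookup (splice k u v) j
  splice-suc-elsewhere k u v {j} j≢k with <-cmp (toℕ j) k
  ... | tri< j<k _ _ = trans (splice-below u v (m<n⇒m<1+n j<k)) (sym (splice-below u v j<k))
  ... | tri≈ _ j≡k _ = contradiction j≡k j≢k
  ... | tri> _ _ k<j = trans (splice-above u v k<j) (sym (splice-above u v (<⇒≤ k<j)))

  DifferOnlyAt : Fin N → Vec A N → Vec A N → Set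
  DifferOnlyAt j u v = lookup u j ≢ lookup v j × (∀ j' → j' ≢ j → lookup u j' ≡ lookup v j')

  module _ {k : ℕ} (u v : Vec A N) {j : Fin N} (j≡k : toℕ j ≡ k) where

    splice-before : lookup (splice k u v) j ≡ lookup u j
    splice-before = splice-above u v (≤-reflexive (sym j≡k))

    splice-after : lookup (splice (suc k) u v) j ≡ lookup v j
    splice-after = splice-below u v (≤-reflexive (cong suc j≡k))

    splice-suc-agreeing : lookup u j ≡ lookup v j → splice (suc k) u v ≡ splice k u v
    splice-suc-agreeing uⱼ≡vⱼ = Pointwise-≡⇒≡ (ext λ j' → pointwise j' (toℕ j' ≟ k))
      where
      pointwise : ∀ j' → Dec (toℕ j' ≡ k) → lookup (splice (suc k) u v) j' ≡ lookup (splice k u v) j'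
      pointwise j' (no j'≢k)  = splice-suc-elsewhere k u v j'≢k
      pointwise j' (yes j'≡k) with refl ← toℕ-injective {i = j'} {j = j} (trans j'≡k (sym j≡k)) =
        trans splice-after (trans (sym uⱼ≡vⱼ) (sym splice-before))

    splice-suc-differing : lookup u j ≢ lookup v j →
                           DifferOnlyAt j (splice k u v) (splice (suc k) u v)
    splice-suc-differing uⱼ≢vⱼ =
        (λ e → uⱼ≢vⱼ (trans (sym splice-before) (trans e splice-after)))
      , λ j' j'≢j → sym (splice-suc-elsewhere k u v
                          (λ j'≡k → j'≢j (toℕ-injective (trans j'≡k (sym j≡k)))))

  record Subcube (Fixed : Fin N → Set) (r w : Vec A N) : Set where
    constructor subcube
    field agrees : ∀ j → Fixed j → lookup w j ≡ lookup r j

  open Subcube public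

  module _ {Fixed : Fin N → Set} {r : Vec A N} where

    subcube-splice : ∀ k u v → Subcube Fixed r u → Subcube Fixed r v → Subcube Fixed r (splice k u v)
    subcube-splice k u v ru rv = subcube λ j fixed → spliced j fixed (toℕ j <? k)
      where
      spliced : ∀ j → Fixed j → Dec (toℕ j < k) → lookup (splice k u v) j ≡ lookup r j
      spliced j fixed (yes j<k) = trans (splice-below u v j<k) (agrees rv j fixed)
      spliced j fixed (no j≮k)  = trans (splice-above u v (≮⇒≥ j≮k)) (agrees ru j fixed)

    subcube-free : ∀ {w w' j} → Subcube Fixed r w → Subcube Fixed r w' →
                   lookup w j ≢ lookup w' j → ¬ Fixed j
    subcube-free {j = j} rw rw' wⱼ≢w'ⱼ fixed =
      wⱼ≢w'ⱼ (trans (agrees rw j fixed) (sym (agrees rw' j fixed)))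

at : ∀ {k} → Vec Bool k → ℕ → Bool
at []       _       = false
at (x ∷ _)  zero    = x
at (_ ∷ xs) (suc i) = at xs i

at-toℕ : ∀ {k} (xs : Vec Bool k) (t : Fin k) → at xs (toℕ t) ≡ lookup xs t
at-toℕ (x ∷ _)  fzero    = refl
at-toℕ (_ ∷ xs) (fsuc t) = at-toℕ xs t

at-++ˡ : ∀ {k l} (xs : Vec Bool k) (ys : Vec Bool l) {i} → i < k → at (xs ++ ys) i ≡ at xs i
at-++ˡ (x ∷ _)  ys {zero}  _         = refl
at-++ˡ (_ ∷ xs) ys {suc i} (s≤s i<k) = at-++ˡ xs ys i<k

at-++ʳ : ∀ {k l} (xs : Vec Bool k) (ys : Vec Bool l) i → at (xs ++ ys) (k + i) ≡ at ys i
at-++ʳ []       ys i = refl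
at-++ʳ (_ ∷ xs) ys i = at-++ʳ xs ys i

at-++-∷ : ∀ {k l} (xs : Vec Bool k) y (ys : Vec Bool l) → at (xs ++ y ∷ ys) k ≡ y
at-++-∷ []       y ys = refl
at-++-∷ (_ ∷ xs) y ys = at-++-∷ xs y ys

module _ {n : ℕ} where

  Adj-sym : ∀ {u v} → Adj n u v → Adj n v u
  Adj-sym (j , uⱼ≢vⱼ , agree , inj₁ (j<n-1 , u0 , v0)) =
    j , uⱼ≢vⱼ ∘ sym , (λ j' j'≢j → sym (agree j' j'≢j)) , inj₁ (j<n-1 , v0 , u0)
  Adj-sym (j , uⱼ≢vⱼ , agree , inj₂ (inj₁ (range , u1 , v1))) =
    j , uⱼ≢vⱼ ∘ sym , (λ j' j'≢j → sym (agree j' j'≢j)) , inj₂ (inj₁ (range , v1 , u1))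
  Adj-sym (j , uⱼ≢vⱼ , agree , inj₂ (inj₂ last)) =
    j , uⱼ≢vⱼ ∘ sym , (λ j' j'≢j → sym (agree j' j'≢j)) , inj₂ (inj₂ last)

  module _ {P : Vertex n → Set} where

    source : ∀ {u v} → InducedPath n P u v → P u
    source (here pu)     = pu
    source (step pu _ _) = pu

    infixr 5 _++ᵖ_
    _++ᵖ_ : ∀ {u v w} → InducedPath n P u v → InducedPath n P v w → InducedPath n P u w
    here _      ++ᵖ q = q
    step pu e p ++ᵖ q = step pu e (p ++ᵖ q)

    reverse : ∀ {u v} → InducedPath n P u v → InducedPath n P v u
    reverse (here pu)             = here pu
    reverse (step {u} {v} pu e p) = reverse p ++ᵖ step (source p) (Adj-sym {u} {v} e) (here pu)

  map : ∀ {P Q : Vertex n → Set} → (∀ {w} → P w → Q w) →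
        ∀ {u v} → InducedPath n P u v → InducedPath n Q u v
  map f (here pu)     = here (f pu)
  map f (step pu e p) = step (f pu) e (map f p)

  module _ {Fixed : Fin (2 * n ∸ 1) → Set} {r : Vertex n}
    (adjacent : ∀ {w w'} j → Subcube Fixed r w → Subcube Fixed r w' →
                DifferOnlyAt j w w' → Adj n w w') where

    subcube-connected : ∀ {u v} → Subcube Fixed r u → Subcube Fixed r v →
                        InducedPath n (Subcube Fixed r) u v
    subcube-connected {u} {v} ru rv =
      subst (InducedPath n _ u) (splice-full u v) (walk (2 * n ∸ 1) ≤-refl)
      where
      spliced : ∀ k → Subcube Fixed r (splice k u v)
      spliced k = subcube-splice k u v ru rv

      walk : ∀ k → k ≤ 2 * n ∸ 1 → InducedPath n (Subcube Fixed r) u (splice k u v)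
      walk zero    _   = subst (InducedPath n _ u) (sym (splice-zero u v)) (here ru)
      walk (suc k) k<N = extend (lookup u j ≟ᴮ lookup v j)
        where
        j : Fin (2 * n ∸ 1)
        j = fromℕ< k<N

        j≡k : toℕ j ≡ k
        j≡k = toℕ-fromℕ< k<N

        extend : Dec (lookup u j ≡ lookup v j) →
                 InducedPath n (Subcube Fixed r) u (splice (suc k) u v)
        extend (yes uⱼ≡vⱼ) =
          subst (InducedPath n _ u) (sym (splice-suc-agreeing u v j≡k uⱼ≡vⱼ)) (walk k (<⇒≤ k<N))
        extend (no uⱼ≢vⱼ) =
          walk k (<⇒≤ k<N) ++ᵖ step (spliced k) flip (here (spliced (suc k)))
          where
          flip : Adj n (splice k u v) (splice (suc k) u v)
          flip = adjacent j (spliced k) (spliced (suc k)) (splice-suc-differing u v j≡k uⱼ≢vⱼ)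

  module _ {J I : Set} (A : J → Vertex n → Set) (B : I → Vertex n → Set)
    (A-connected : ∀ j {u v} → A j u → A j v → InducedPath n (A j) u v)
    (B-connected : ∀ i {u v} → B i u → B i v → InducedPath n (B i) u v)
    (linked : ∀ j i → ∃₂ λ x y → A j x × B i y × Adj n x y) where

    private
      Union : Vertex n → Set
      Union u = ∃ (λ j → A j u) ⊎ ∃ (λ i → B i u)

      left right : J → I → Vertex n
      left  j i = proj₁ (linked j i)
      right j i = proj₁ (proj₂ (linked j i))

      left∈A : ∀ j i → A j (left j i)
      left∈A j i = let (_ , _ , x∈A , _ , _) = linked j i in x∈A

      right∈B : ∀ j i → B i (right j i)
      right∈B j i = let (_ , _ , _ , y∈B , _) = linked j i in y∈B

      link : ∀ j i → InducedPath n Union (left j i) (right j i)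
      link j i = let (_ , _ , x∈A , y∈B , e) = linked j i in
        step (inj₁ (j , x∈A)) e (here (inj₂ (i , y∈B)))

      within-A : ∀ j {u v} → A j u → A j v → InducedPath n Union u v
      within-A j u∈A v∈A = map (λ w∈A → inj₁ (j , w∈A)) (A-connected j u∈A v∈A)

      within-B : ∀ i {u v} → B i u → B i v → InducedPath n Union u v
      within-B i u∈B v∈B = map (λ w∈B → inj₂ (i , w∈B)) (B-connected i u∈B v∈B)

    linked-union-connected : J → I → InducedConnected n Union
    linked-union-connected j₀ i₀ =
      (hub , inj₁ (j₀ , left∈A j₀ i₀)) ,
      λ u v u∈U v∈U → to-hub u∈U ++ᵖ reverse (to-hub v∈U)
      where
      hub : Vertex n
      hub = left j₀ i₀

      to-hub : ∀ {u} → Union u → InducedPath n Union u hub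
      to-hub (inj₁ (j , u∈A)) =
            within-A j u∈A (left∈A j i₀)
        ++ᵖ link j i₀
        ++ᵖ within-B i₀ (right∈B j i₀) (right∈B j₀ i₀)
        ++ᵖ reverse (link j₀ i₀)
      to-hub (inj₂ (i , u∈B)) =
            within-B i u∈B (right∈B j₀ i)
        ++ᵖ reverse (link j₀ i)
        ++ᵖ within-A j₀ (left∈A j₀ i) (left∈A j₀ i₀)

module _ {m : ℕ} where

  vertex-length : 2 * suc m ∸ 1 ≡ suc (m + m)
  vertex-length = trans (cong (m +_) (+-identityʳ (suc m))) (+-suc m m)

  last-position : 2 * suc m ∸ 2 ≡ m + m
  last-position = cong (_∸ 1) vertex-length

  position≤ : (j : Fin (2 * suc m ∸ 1)) → toℕ j ≤ m + m
  position≤ j = ≤-pred (subst (toℕ j <_) vertex-length (toℕ<n j))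

  upper-half : ∀ {i} → m ≤ i → i < m + m → Σ (Fin m) λ t → i ≡ m + toℕ t
  upper-half {i} m≤i i<2m =
    fromℕ< offset<m , trans (sym (m+[n∸m]≡n m≤i)) (cong (m +_) (sym (toℕ-fromℕ< offset<m)))
    where
    offset<m : i ∸ m < m
    offset<m = subst (i ∸ m <_) (m+n∸m≡n m m) (∸-monoˡ-< i<2m m≤i)

  junction : Vec Bool m → Vec Bool m → Bool → Vertex (suc m)
  junction a b c = tabulate λ j → at ((b ++ a) ++ c ∷ []) (toℕ j)

  module _ (a b : Vec Bool m) where

    junction-last : ∀ c → LastBit (suc m) (junction a b c) c
    junction-last c j j≡last = begin
      lookup (junction a b c) j    ≡⟨ lookup∘tabulate _ j ⟩
      at bits (toℕ j)              ≡⟨ cong (at bits) (trans j≡last last-position) ⟩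
      at bits (m + m)              ≡⟨ at-++-∷ (b ++ a) c [] ⟩
      c                            ∎
      where
      open ≡-Reasoning
      bits : Vec Bool (m + m + 1)
      bits = (b ++ a) ++ c ∷ []

    junction-prefix : ∀ c {j} → toℕ j < m + m → lookup (junction a b c) j ≡ at (b ++ a) (toℕ j)
    junction-prefix c {j} j<2m = trans (lookup∘tabulate _ j) (at-++ˡ (b ++ a) (c ∷ []) j<2m)

    junction-class0 : InCluster0 (suc m) a (junction a b false)
    junction-class0 = junction-last false , label
      where
      open ≡-Reasoning
      label : ∀ j t → toℕ j ≡ m + toℕ t → lookup (junction a b false) j ≡ lookup a t
      label j t j≡m+t = begin
        lookup (junction a b false) j  ≡⟨ junction-prefix false j<2m ⟩
        at (b ++ a) (toℕ j)            ≡⟨ cong (at (b ++ a)) j≡m+t ⟩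
        at (b ++ a) (m + toℕ t)        ≡⟨ at-++ʳ b a (toℕ t) ⟩
        at a (toℕ t)                   ≡⟨ at-toℕ a t ⟩
        lookup a t                     ∎
        where
        j<2m : toℕ j < m + m
        j<2m = subst (_< m + m) (sym j≡m+t) (+-monoʳ-< m (toℕ<n t))

    junction-class1 : InCluster1 (suc m) b (junction a b true)
    junction-class1 = junction-last true , label
      where
      open ≡-Reasoning
      label : ∀ j t → toℕ j ≡ toℕ t → lookup (junction a b true) j ≡ lookup b t
      label j t j≡t = begin
        lookup (junction a b true) j  ≡⟨ junction-prefix true j<2m ⟩
        at (b ++ a) (toℕ j)           ≡⟨ cong (at (b ++ a)) j≡t ⟩
        at (b ++ a) (toℕ t)           ≡⟨ at-++ˡ b a (toℕ<n t) ⟩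
        at b (toℕ t)                  ≡⟨ at-toℕ b t ⟩
        lookup b t                    ∎
        where
        j<2m : toℕ j < m + m
        j<2m = subst (_< m + m) (sym j≡t) (m≤n⇒m≤n+o m (toℕ<n t))

    junction-flip : Adj (suc m) (junction a b false) (junction a b true)
    junction-flip = last , differ , agree , inj₂ (inj₂ last≡)
      where
      last : Fin (2 * suc m ∸ 1)
      last = fromℕ< (subst (m + m <_) (sym vertex-length) (n<1+n (m + m)))

      last≡ : toℕ last ≡ 2 * suc m ∸ 2
      last≡ = trans (toℕ-fromℕ< _) (sym last-position)

      differ : lookup (junction a b false) last ≢ lookup (junction a b true) last
      differ e with () ← trans (sym (junction-last false last last≡))
                               (trans e (junction-last true last last≡))

      agree : ∀ j → j ≢ last → lookup (junction a b false) j ≡ lookup (junction a b true) j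
      agree j j≢last = trans (junction-prefix false j<2m) (sym (junction-prefix true j<2m))
        where
        j<2m : toℕ j < m + m
        j<2m = ≤∧≢⇒< (position≤ j)
          λ j≡2m → j≢last (toℕ-injective (trans j≡2m (sym (trans last≡ last-position))))

  junction-link : (a b : Vec Bool m) →
                  ∃₂ λ x y → InCluster0 (suc m) a x × InCluster1 (suc m) b y × Adj (suc m) x y
  junction-link a b =
    junction a b false , junction a b true , junction-class0 a b , junction-class1 a b , junction-flip a b

  Class0Fixed : Fin (2 * suc m ∸ 1) → Set
  Class0Fixed j = m ≤ toℕ j

  module _ (a : Vec Bool m) {u : Vertex (suc m)} (u∈C : InCluster0 (suc m) a u) where

    cluster0-subcube : ∀ {v} → InCluster0 (suc m) a v → Subcube Class0Fixed u v
    cluster0-subcube {v} v∈C = subcube λ j m≤j → agreement j m≤j (m≤n⇒m<n∨m≡n (position≤ j))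
      where
      agreement : ∀ j → m ≤ toℕ j → toℕ j < m + m ⊎ toℕ j ≡ m + m → lookup v j ≡ lookup u j
      agreement j m≤j (inj₁ j<2m) = let (t , j≡m+t) = upper-half m≤j j<2m in
        trans (proj₂ v∈C j t j≡m+t) (sym (proj₂ u∈C j t j≡m+t))
      agreement j _ (inj₂ j≡2m) = let j≡last = trans j≡2m (sym last-position) in
        trans (proj₁ v∈C j j≡last) (sym (proj₁ u∈C j j≡last))

    subcube-cluster0 : ∀ {w} → Subcube Class0Fixed u w → InCluster0 (suc m) a w
    subcube-cluster0 uw =
        (λ j j≡last → trans (agrees uw j (subst (m ≤_) (sym (trans j≡last last-position)) (m≤m+n m m)))
                            (proj₁ u∈C j j≡last))
      , λ j t j≡m+t → trans (agrees uw j (subst (m ≤_) (sym j≡m+t) (m≤m+n m (toℕ t))))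
                            (proj₂ u∈C j t j≡m+t)

  cluster0-connected : ∀ a {u v} → InCluster0 (suc m) a u → InCluster0 (suc m) a v →
                       InducedPath (suc m) (InCluster0 (suc m) a) u v
  cluster0-connected a {u} u∈C v∈C =
    map (subcube-cluster0 a u∈C)
        (subcube-connected adjacent (subcube λ _ _ → refl) (cluster0-subcube a u∈C v∈C))
    where
    adjacent : ∀ {w w'} j → Subcube Class0Fixed u w → Subcube Class0Fixed u w' →
               DifferOnlyAt j w w' → Adj (suc m) w w'
    adjacent j uw uw' (wⱼ≢w'ⱼ , agree) =
      j , wⱼ≢w'ⱼ , agree ,
      inj₁ ( ≰⇒> (subcube-free uw uw' wⱼ≢w'ⱼ)
           , proj₁ (subcube-cluster0 a u∈C uw) , proj₁ (subcube-cluster0 a u∈C uw'))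

  Class1Fixed : Fin (2 * suc m ∸ 1) → Set
  Class1Fixed j = toℕ j < m ⊎ m + m ≤ toℕ j

  module _ (b : Vec Bool m) {u : Vertex (suc m)} (u∈C : InCluster1 (suc m) b u) where

    cluster1-subcube : ∀ {v} → InCluster1 (suc m) b v → Subcube Class1Fixed u v
    cluster1-subcube {v} v∈C = subcube agreement
      where
      agreement : ∀ j → Class1Fixed j → lookup v j ≡ lookup u j
      agreement j (inj₁ j<m) = let t = fromℕ< j<m ; j≡t = sym (toℕ-fromℕ< j<m) in
        trans (proj₂ v∈C j t j≡t) (sym (proj₂ u∈C j t j≡t))
      agreement j (inj₂ 2m≤j) = let j≡last = trans (≤-antisym (position≤ j) 2m≤j) (sym last-position) in
        trans (proj₁ v∈C j j≡last) (sym (proj₁ u∈C j j≡last))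

    subcube-cluster1 : ∀ {w} → Subcube Class1Fixed u w → InCluster1 (suc m) b w
    subcube-cluster1 uw =
        (λ j j≡last → trans (agrees uw j (inj₂ (≤-reflexive (sym (trans j≡last last-position)))))
                            (proj₁ u∈C j j≡last))
      , λ j t j≡t → trans (agrees uw j (inj₁ (subst (_< m) (sym j≡t) (toℕ<n t))))
                          (proj₂ u∈C j t j≡t)

  cluster1-connected : ∀ b {u v} → InCluster1 (suc m) b u → InCluster1 (suc m) b v →
                       InducedPath (suc m) (InCluster1 (suc m) b) u v
  cluster1-connected b {u} u∈C v∈C =
    map (subcube-cluster1 b u∈C)
        (subcube-connected adjacent (subcube λ _ _ → refl) (cluster1-subcube b u∈C v∈C))
    where
    adjacent : ∀ {w w'} j → Subcube Class1Fixed u w → Subcube Class1Fixed u w' →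
               DifferOnlyAt j w w' → Adj (suc m) w w'
    adjacent j uw uw' (wⱼ≢w'ⱼ , agree) =
      j , wⱼ≢w'ⱼ , agree ,
      inj₂ (inj₁ ((m≤j , j<last) , proj₁ (subcube-cluster1 b u∈C uw) , proj₁ (subcube-cluster1 b u∈C uw')))
      where
      free : ¬ Class1Fixed j
      free = subcube-free uw uw' wⱼ≢w'ⱼ

      m≤j : m ≤ toℕ j
      m≤j = ≮⇒≥ (free ∘ inj₁)

      j<last : toℕ j < 2 * suc m ∸ 2
      j<last = subst (toℕ j <_) (sym last-position) (≰⇒> (free ∘ inj₂))

-- Only n ≥ 1 and nonempty index sets are used: the clusters need not be distinct.
theorem7 : (n : ℕ) → 3 ≤ n → (k l : ℕ) → 1 ≤ k → 1 ≤ l →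
    (C : Fin k → Vec Bool (n ∸ 1)) → Injective _≡_ _≡_ C →
    (C' : Fin l → Vec Bool (n ∸ 1)) → Injective _≡_ _≡_ C' →
    InducedConnected n (λ u → (∃ λ j → InCluster0 n (C j) u) ⊎ (∃ λ i → InCluster1 n (C' i) u))
theorem7 (suc m) _ (suc k) (suc l) _ _ C _ C' _ =
  linked-union-connected (InCluster0 (suc m) ∘ C) (InCluster1 (suc m) ∘ C')
    (cluster0-connected ∘ C) (cluster1-connected ∘ C') (λ j i → junction-link (C j) (C' i))
    fzero fzero
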